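{- Let $D$ be an integral domain and $d\ge 2$ an integer. In the Coefficient-Choosing Game with parameters $D$ and $d$, if Wanda makes the last play (i.e. chooses the last remaining coefficient), then Wanda has a winning strategy.
   Context: The Coefficient-Choosing Game with parameters an integral domain $D$ and a degree $d\ge 2$: one of two players, Wanda or Nora, is designated Player I and the other Player II. Starting with Player I, the players alternately choose the coefficients $a_0,\dots,a_d\in D$ of a polynomial $f(x)=a_dx^d+\cdots+a_1x+a_0$; on each turn the player picks any not-yet-chosen index $i$ (the order is not predetermined) and a value $a_i\in D$, subject to the rule that $a_d\neq 0$ and $a_0\neq 0$. When all $d+1$ coefficients are chosen, Wanda wins if $f$ has a root in the field of fractions of $D$, and Nora wins otherwise. "A player wins" means that player has a strategy that wins no matter how the other plays. -}

module Defs where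

open import Level using (Level; _⊔_) renaming (suc to lsuc)
open import Algebra.Bundles using (CommutativeRing)
open import Data.Nat using (ℕ; zero; suc)
open import Data.Fin using (Fin; toℕ; _≟_) renaming (zero to fzero; suc to fsuc)
open import Data.Maybe using (Maybe; just; nothing; fromMaybe)
open import Data.Product using (Σ; _×_; _,_)
open import Data.Sum using (_⊎_)
open import Relation.Nullary using (¬_; yes; no)
open import Relation.Binary.PropositionalEquality using (_≡_)

record IntegralDomain (c ℓ : Level) : Set (lsuc (c ⊔ ℓ)) where
  field
    commutativeRing : CommutativeRing c ℓ
  open CommutativeRing commutativeRing public
  field
    1≉0            : ¬ (1# ≈ 0#)
    noZeroDivisors : ∀ x y → x * y ≈ 0# → x ≈ 0# ⊎ y ≈ 0#

module _ {c ℓ} (D : IntegralDomain c ℓ) where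
  open IntegralDomain D

  record Frac : Set (c ⊔ ℓ) where
    constructor _/_∣_
    field
      num : Carrier
      den : Carrier
      den≉0 : ¬ (den ≈ 0#)
  open Frac

  private
    nz* : ∀ {x y} → ¬ (x ≈ 0#) → ¬ (y ≈ 0#) → ¬ (x * y ≈ 0#)
    nz* {x} {y} hx hy e with noZeroDivisors x y e
    ... | Data.Sum.inj₁ p = hx p
    ... | Data.Sum.inj₂ p = hy p

  _≈F_ : Frac → Frac → Set ℓ
  u ≈F v = num u * den v ≈ num v * den u

  0F 1F : Frac
  0F = 0# / 1# ∣ 1≉0
  1F = 1# / 1# ∣ 1≉0

  ι : Carrier → Frac
  ι a = a / 1# ∣ 1≉0

  _+F_ : Frac → Frac → Frac
  u +F v = (num u * den v + num v * den u) / (den u * den v) ∣ nz* (den≉0 u) (den≉0 v)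

  _*F_ : Frac → Frac → Frac
  u *F v = (num u * num v) / (den u * den v) ∣ nz* (den≉0 u) (den≉0 v)

  _^F_ : Frac → ℕ → Frac
  x ^F zero  = 1F
  x ^F suc n = x *F (x ^F n)

  sumF : ∀ n → (Fin n → Frac) → Frac
  sumF zero    f = 0F
  sumF (suc n) f = f fzero +F sumF n (λ i → f (fsuc i))

  evalF : ∀ d → (Fin (suc d) → Carrier) → Frac → Frac
  evalF d a x = sumF (suc d) (λ i → ι (a i) *F (x ^F toℕ i))

  HasRootInFrac : ∀ d → (Fin (suc d) → Carrier) → Set (c ⊔ ℓ)
  HasRootInFrac d a = Σ Frac λ x → evalF d a x ≈F 0F

data Player : Set where
  wanda nora : Player

other : Player → Player
other wanda = nora
other nora  = wanda

-- the player making move number n (counting from 0) when p is Player I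
mover : Player → ℕ → Player
mover p zero    = p
mover p (suc n) = mover (other p) n

module _ {c ℓ} (D : IntegralDomain c ℓ) (d : ℕ) where
  open IntegralDomain D

  -- a position: which coefficients a_0 … a_d are chosen so far
  Position : Set c
  Position = Fin (suc d) → Maybe Carrier

  empty : Position
  empty _ = nothing

  update : Position → Fin (suc d) → Carrier → Position
  update pos i a j with j ≟ i
  ... | yes _ = just a
  ... | no  _ = pos j

  Legal : Fin (suc d) → Carrier → Set ℓ
  Legal i a = (toℕ i ≡ 0 ⊎ toℕ i ≡ d) → ¬ (a ≈ 0#)

  -- WandaWins k p pos : from position pos, with k moves remaining and
  -- player p to move, Wanda has a strategy that wins against every play
  -- of Nora.  (The game has finite length, so this is the usual
  -- backward-induction definition of having a winning strategy.)
  WandaWins : ℕ → Player → Position → Set (c ⊔ ℓ)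
  WandaWins zero    _     pos = HasRootInFrac D d (λ i → fromMaybe 0# (pos i))
  WandaWins (suc k) wanda pos =
    Σ (Fin (suc d)) λ i → Σ Carrier λ a →
      (pos i ≡ nothing) × Legal i a × WandaWins k nora (update pos i a)
  WandaWins (suc k) nora  pos =
    ∀ i a → pos i ≡ nothing → Legal i a → WandaWins k wanda (update pos i a)

  WandaHasWinningStrategy : Player → Set (c ⊔ ℓ)
  WandaHasWinningStrategy first = WandaWins (suc d) first empty

module Submission where

-- Strategy: aim for the root x = 1, i.e. for a_0 + a_1 + ⋯ + a_d = 0.  Pair
-- the index i with its reflection d − i.  Whenever Nora chooses a_i = a, Wanda
-- answers a_{d−i} = −a; this is legal, since i is an endpoint iff d − i is.
-- If d is odd no index is its own partner and Nora moves first, so Wanda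
-- simply answers every move.  If d = 2k is even Wanda moves first and opens
-- with a_k = 0 (legal because 0 < k < d); afterwards she answers as before.
-- The invariant kept after each of Wanda's moves (`Balanced`) is: chosen
-- indices are closed under reflection, partner coefficients cancel, and the
-- middle coefficient is 0.  At the end all coefficients cancel in pairs, so
-- they sum to 0 and 1 is a root.

open import Defs
open import Level using (_⊔_)
open import Data.Nat using (ℕ; _≤_)
open import Relation.Binary.PropositionalEquality using (_≡_)
open import Axiom.ExcludedMiddle using (ExcludedMiddle)

open import Algebra.Bundles using (CommutativeMonoid)
open import Data.Nat using (zero; suc)
open import Data.Fin using (Fin; toℕ; inject₁; fromℕ<; opposite; _≟_)
  renaming (zero to fzero; suc to fsuc)
open import Data.Fin.Properties using (opposite-involutive)
open import Data.Maybe using (just; nothing; fromMaybe)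
open import Data.Product using (∃-syntax; _×_; _,_)
open import Data.Sum using (_⊎_; inj₁; inj₂)
open import Data.Empty using (⊥-elim)
open import Relation.Nullary using (¬_; yes; no)
open import Function using (_∘_)
import Relation.Binary.PropositionalEquality as ≡

module Indices where
  open import Data.Nat using (_+_; s≤s)
  open import Data.Nat.Properties using (+-suc; +-identityʳ; +-cancelˡ-≡; +-cancelʳ-≡; m≤m+n; m+[n∸m]≡n; suc-injective)
  open import Data.Fin.Properties using (toℕ-injective; toℕ-fromℕ<; toℕ≤pred[n]; opposite-prop)
  open ≡ using (refl; sym; trans; cong; subst)
  open ≡.≡-Reasoning

  -- double k = 2k, defined so that double (suc k) reduces to two moves.
  double : ℕ → ℕ
  double zero    = zero
  double (suc k) = suc (suc (double k))

  double≡+ : ∀ n → double n ≡ n + n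
  double≡+ zero    = refl
  double≡+ (suc n) = cong suc (trans (cong suc (double≡+ n)) (sym (+-suc n n)))

  double-injective : ∀ {m n} → double m ≡ double n → m ≡ n
  double-injective {zero}  {zero}  _ = refl
  double-injective {suc m} {suc n} e = cong suc (double-injective (suc-injective (suc-injective e)))

  double≢odd : ∀ m n → ¬ double m ≡ suc (double n)
  double≢odd (suc m) (suc n) e = double≢odd m n (suc-injective (suc-injective e))

  parity : ∀ n → (∃[ k ] n ≡ double k) ⊎ (∃[ k ] n ≡ suc (double k))
  parity zero = inj₁ (0 , refl)
  parity (suc n) with parity n
  ... | inj₁ (k , refl) = inj₂ (k , refl)
  ... | inj₂ (k , refl) = inj₁ (suc k , refl)

  mover-even : ∀ p k → mover p (double k) ≡ p
  mover-even p     zero    = refl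
  mover-even wanda (suc k) = mover-even wanda k
  mover-even nora  (suc k) = mover-even nora k

  -- Move number d is the last of the d + 1 moves.  Wanda makes it exactly
  -- when d is even and she starts, or d is odd and Nora starts.
  wanda-moves-last : ∀ first d → mover first d ≡ wanda
    → (∃[ k ] (d ≡ double k × first ≡ wanda)) ⊎ (∃[ k ] (d ≡ suc (double k) × first ≡ nora))
  wanda-moves-last first d last with parity d
  ... | inj₁ (k , refl) = inj₁ (k , refl , trans (sym (mover-even first k)) last)
  ... | inj₂ (k , refl) = inj₂ (k , refl , other≡wanda (trans (sym (mover-even (other first) k)) last))
    where
    other≡wanda : ∀ {p} → other p ≡ wanda → p ≡ nora
    other≡wanda {nora} _ = refl

  Endpoint : ∀ d → Fin (suc d) → Set
  Endpoint d i = toℕ i ≡ 0 ⊎ toℕ i ≡ d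

  toℕ-opposite : ∀ {d} (i : Fin (suc d)) → toℕ i + toℕ (opposite i) ≡ d
  toℕ-opposite i = trans (cong (toℕ i +_) (opposite-prop i)) (m+[n∸m]≡n (toℕ≤pred[n] i))

  opposite-injective : ∀ {n} {i j : Fin n} → opposite i ≡ opposite j → i ≡ j
  opposite-injective {i = i} {j} e =
    trans (sym (opposite-involutive i)) (trans (cong opposite e) (opposite-involutive j))

  -- Reflection commutes with the embedding k ↦ k + 1 of Fin (suc n) into the
  -- interior of Fin (suc (suc (suc n))); this drives induction on paired sums.
  opposite-inject₁ : ∀ {n} (k : Fin (suc n)) → opposite (inject₁ k) ≡ fsuc (opposite k)
  opposite-inject₁ fzero            = refl
  opposite-inject₁ {suc n} (fsuc k) = cong inject₁ (opposite-inject₁ k)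

  opposite-inner : ∀ {n} (k : Fin (suc n)) → opposite (fsuc (inject₁ k)) ≡ fsuc (inject₁ (opposite k))
  opposite-inner k = cong inject₁ (opposite-inject₁ k)

  opposite-endpoint : ∀ {d} (i : Fin (suc d)) → Endpoint d (opposite i) → Endpoint d i
  opposite-endpoint {d} i (inj₁ opp≡0) = inj₂ (begin
    toℕ i                    ≡⟨ sym (+-identityʳ (toℕ i)) ⟩
    toℕ i + 0                ≡⟨ cong (toℕ i +_) (sym opp≡0) ⟩
    toℕ i + toℕ (opposite i) ≡⟨ toℕ-opposite i ⟩
    d                        ∎)
  opposite-endpoint {d} i (inj₂ opp≡d) =
    inj₁ (+-cancelʳ-≡ d (toℕ i) 0 (trans (cong (toℕ i +_) (sym opp≡d)) (toℕ-opposite i)))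

  opposite-fixed : ∀ {d} (i : Fin (suc d)) → opposite i ≡ i → double (toℕ i) ≡ d
  opposite-fixed i fixed = trans (double≡+ (toℕ i)) (subst (λ j → toℕ i + toℕ j ≡ _) fixed (toℕ-opposite i))

  no-midpoint : ∀ k (i : Fin (suc (suc (double k)))) → ¬ opposite i ≡ i
  no-midpoint k i fixed = double≢odd (toℕ i) k (opposite-fixed i fixed)

  midpoint : ∀ k → Fin (suc (double k))
  midpoint k = fromℕ< (s≤s (subst (k ≤_) (sym (double≡+ k)) (m≤m+n k k)))

  toℕ-midpoint : ∀ k → toℕ (midpoint k) ≡ k
  toℕ-midpoint k = toℕ-fromℕ< _

  fixed⇒midpoint : ∀ k (i : Fin (suc (double k))) → opposite i ≡ i → i ≡ midpoint k
  fixed⇒midpoint k i fixed =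
    toℕ-injective (trans (double-injective (opposite-fixed i fixed)) (sym (toℕ-midpoint k)))

  midpoint-fixed : ∀ k → opposite (midpoint k) ≡ midpoint k
  midpoint-fixed k = toℕ-injective (+-cancelˡ-≡ k _ _ (begin
    k + toℕ (opposite m)       ≡⟨ cong (_+ toℕ (opposite m)) (sym (toℕ-midpoint k)) ⟩
    toℕ m + toℕ (opposite m)   ≡⟨ toℕ-opposite m ⟩
    double k                   ≡⟨ double≡+ k ⟩
    k + k                      ≡⟨ cong (k +_) (sym (toℕ-midpoint k)) ⟩
    k + toℕ m                  ∎))
    where
    m = midpoint k

  midpoint-interior : ∀ k → 2 ≤ double k → ¬ Endpoint (double k) (midpoint k)
  midpoint-interior k 2≤d end = half-positive k 2≤d (k≡0 end)
    where
    half-positive : ∀ k → 2 ≤ double k → ¬ k ≡ 0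
    half-positive zero    ()
    half-positive (suc k) _ ()
    k≡0 : Endpoint (double k) (midpoint k) → k ≡ 0
    k≡0 (inj₁ m≡0) = trans (sym (toℕ-midpoint k)) m≡0
    k≡0 (inj₂ m≡d) = sym (+-cancelˡ-≡ k 0 k (begin
      k + 0    ≡⟨ +-identityʳ k ⟩
      k        ≡⟨ trans (sym (toℕ-midpoint k)) m≡d ⟩
      double k ≡⟨ double≡+ k ⟩
      k + k    ∎))

open Indices

module PairedSum {a ℓ} (M : CommutativeMonoid a ℓ) where
  open CommutativeMonoid M renaming (_∙_ to _+_; ε to 0#; ∙-cong to +-cong; ∙-congˡ to +-congˡ)
  open import Algebra.Properties.CommutativeMonoid.Sum M using (sum; sum-init-last)
  open import Relation.Binary.Reasoning.Setoid setoid

  paired-sum : ∀ d (t : Fin (suc d) → Carrier)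
    → (∀ i → t i + t (opposite i) ≈ 0#)
    → (∀ i → opposite i ≡ i → t i ≈ 0#)
    → sum t ≈ 0#
  paired-sum zero t cancel middle = begin
    t fzero + 0# ≈⟨ identityʳ _ ⟩
    t fzero      ≈⟨ middle fzero ≡.refl ⟩
    0#           ∎
  paired-sum (suc zero) t cancel middle = begin
    t fzero + (t (fsuc fzero) + 0#) ≈⟨ +-congˡ (identityʳ _) ⟩
    t fzero + t (fsuc fzero)        ≈⟨ cancel fzero ⟩
    0#                              ∎
  paired-sum (suc (suc m)) t cancel middle = begin
    t fzero + sum (λ i → t (fsuc i))           ≈⟨ +-congˡ (sum-init-last (λ i → t (fsuc i))) ⟩
    t fzero + (sum inner + t (opposite fzero)) ≈⟨ +-congˡ (comm _ _) ⟩
    t fzero + (t (opposite fzero) + sum inner) ≈⟨ sym (assoc _ _ _) ⟩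
    (t fzero + t (opposite fzero)) + sum inner ≈⟨ +-cong (cancel fzero) inner-sum ⟩
    0# + 0#                                    ≈⟨ identityʳ 0# ⟩
    0#                                         ∎
    where
    -- the terms strictly between the two ends, indexed by Fin (suc m)
    inner : Fin (suc m) → Carrier
    inner k = t (fsuc (inject₁ k))
    inner-sum : sum inner ≈ 0#
    inner-sum = paired-sum m inner
      (λ k → ≡.subst (λ j → inner k + t j ≈ 0#) (opposite-inner k) (cancel (fsuc (inject₁ k))))
      (λ k fixed → middle (fsuc (inject₁ k)) (≡.trans (opposite-inner k) (≡.cong (fsuc ∘ inject₁) fixed)))

module _ {c ℓ} (D : IntegralDomain c ℓ) where
  open IntegralDomain D
  open Frac
  open import Algebra.Properties.CommutativeMonoid.Sum +-commutativeMonoid using (sum)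
  open import Relation.Binary.Reasoning.Setoid setoid

  -- u represents x when u is the fraction x / 1 up to ≈; such fractions are
  -- closed under the operations of Frac(D), which then compute as in D.
  record _Represents_ (u : Frac D) (x : Carrier) : Set ℓ where
    constructor represents
    field
      num≈ : num u ≈ x
      den≈1 : den u ≈ 1#
  open _Represents_

  represents-≈ : ∀ {u x y} → u Represents x → x ≈ y → u Represents y
  represents-≈ (represents num≈x den≈1) x≈y = represents (trans num≈x x≈y) den≈1

  +F-represents : ∀ {u v x y} → u Represents x → v Represents y → _+F_ D u v Represents (x + y)
  +F-represents {u} {v} {x} {y} (represents nu du) (represents nv dv) = represents
    (begin
      num u * den v + num v * den u ≈⟨ +-cong (*-cong nu dv) (*-cong nv du) ⟩
      x * 1# + y * 1#               ≈⟨ +-cong (*-identityʳ x) (*-identityʳ y) ⟩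
      x + y                         ∎)
    (trans (*-cong du dv) (*-identityʳ 1#))

  *F-represents : ∀ {u v x y} → u Represents x → v Represents y → _*F_ D u v Represents (x * y)
  *F-represents (represents nu du) (represents nv dv) =
    represents (*-cong nu nv) (trans (*-cong du dv) (*-identityʳ 1#))

  ι-represents : ∀ x → ι D x Represents x
  ι-represents x = represents refl refl

  power-of-one : ∀ k → _^F_ D (1F D) k Represents 1#
  power-of-one zero    = ι-represents 1#
  power-of-one (suc k) = represents-≈ (*F-represents (ι-represents 1#) (power-of-one k)) (*-identityʳ 1#)

  sumF-represents : ∀ n {f : Fin n → Frac D} {g : Fin n → Carrier}
    → (∀ i → f i Represents g i) → sumF D n f Represents sum g
  sumF-represents zero    _  = represents refl refl
  sumF-represents (suc n) fg = +F-represents (fg fzero) (sumF-represents n (fg ∘ fsuc))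

  -- f(1) = a_0 + ⋯ + a_d, so a polynomial whose coefficients sum to 0 has the root 1.
  root-at-one : ∀ d (a : Fin (suc d) → Carrier) → sum a ≈ 0# → HasRootInFrac D d a
  root-at-one d a sum≈0 = 1F D , (begin
    num f1 * 1# ≈⟨ *-identityʳ _ ⟩
    num f1      ≈⟨ num≈ f1-represents ⟩
    sum a       ≈⟨ sum≈0 ⟩
    0#          ≈⟨ sym (zeroˡ _) ⟩
    0# * den f1 ∎)
    where
    f1 : Frac D
    f1 = evalF D d a (1F D)
    f1-represents : f1 Represents sum a
    f1-represents = sumF-represents (suc d)
      (λ i → represents-≈ (*F-represents (ι-represents (a i)) (power-of-one (toℕ i))) (*-identityʳ (a i)))

  open PairedSum +-commutativeMonoid using (paired-sum)
  open import Algebra.Properties.AbelianGroup +-abelianGroup using (⁻¹-injective; ε⁻¹≈ε)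

  -≈0⇒≈0 : ∀ {x} → - x ≈ 0# → x ≈ 0#
  -≈0⇒≈0 -x≈0 = ⁻¹-injective (trans -x≈0 (sym ε⁻¹≈ε))

  just≢nothing : ∀ {x : Carrier} → ¬ just x ≡ nothing
  just≢nothing ()

  module Game (d : ℕ) where
    -- the coefficient a_i of a position (0 while still unchosen)
    value : Position D d → Fin (suc d) → Carrier
    value pos i = fromMaybe 0# (pos i)

    update-same : ∀ pos i a → update D d pos i a i ≡ just a
    update-same pos i a with i ≟ i
    ... | yes _   = ≡.refl
    ... | no  i≢i = ⊥-elim (i≢i ≡.refl)

    update-other : ∀ pos i a j → ¬ j ≡ i → update D d pos i a j ≡ pos j
    update-other pos i a j j≢i with j ≟ i
    ... | yes j≡i = ⊥-elim (j≢i j≡i)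
    ... | no  _   = ≡.refl

    record Balanced (pos : Position D d) : Set (c ⊔ ℓ) where
      field
        paired  : ∀ i → pos i ≡ nothing → pos (opposite i) ≡ nothing
        cancels : ∀ i → value pos i + value pos (opposite i) ≈ 0#
        middle  : ∀ i → opposite i ≡ i → pos i ≡ just 0#
    open Balanced

    balanced-sum : ∀ {pos} → Balanced pos → sum (value pos) ≈ 0#
    balanced-sum {pos} bal = paired-sum d (value pos) (cancels bal)
      (λ i fixed → reflexive (≡.cong (fromMaybe 0#) (middle bal i fixed)))

    legal-answer : ∀ i a → Legal D d i a → Legal D d (opposite i) (- a)
    legal-answer i a legal end -a≈0 = legal (opposite-endpoint i end) (-≈0⇒≈0 -a≈0)

    answer : Position D d → Fin (suc d) → Carrier → Position D d
    answer pos i a = update D d (update D d pos i a) (opposite i) (- a)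

    module Answer {pos : Position D d} (bal : Balanced pos)
                  (i : Fin (suc d)) (a : Carrier) (free : pos i ≡ nothing) where
      -- a free index is not the middle one, which is always chosen
      i≢opposite : ¬ i ≡ opposite i
      i≢opposite i≡opp = just≢nothing (≡.trans (≡.sym (middle bal i (≡.sym i≡opp))) free)

      partner-free : update D d pos i a (opposite i) ≡ nothing
      partner-free = ≡.trans (update-other pos i a (opposite i) (i≢opposite ∘ ≡.sym)) (paired bal i free)

      at-i : answer pos i a i ≡ just a
      at-i = ≡.trans (update-other _ (opposite i) (- a) i i≢opposite) (update-same pos i a)

      at-opposite : answer pos i a (opposite i) ≡ just (- a)
      at-opposite = update-same _ (opposite i) (- a)

      elsewhere : ∀ x → ¬ x ≡ i → ¬ x ≡ opposite i → answer pos i a x ≡ pos x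
      elsewhere x x≢i x≢opp = ≡.trans (update-other _ (opposite i) (- a) x x≢opp) (update-other pos i a x x≢i)

      opposite-elsewhere : ∀ x → ¬ x ≡ i → ¬ x ≡ opposite i → ¬ opposite x ≡ i × ¬ opposite x ≡ opposite i
      opposite-elsewhere x x≢i x≢opp =
        (λ opp≡i → x≢opp (≡.trans (≡.sym (opposite-involutive x)) (≡.cong opposite opp≡i))) ,
        (λ opp≡opp → x≢i (opposite-injective opp≡opp))

      data Place (x : Fin (suc d)) : Set where
        at-first  : x ≡ i → Place x
        at-second : x ≡ opposite i → Place x
        outside   : ¬ x ≡ i → ¬ x ≡ opposite i → Place x

      place : ∀ x → Place x
      place x with x ≟ i | x ≟ opposite i
      ... | yes x≡i | _         = at-first x≡i
      ... | no  _   | yes x≡opp = at-second x≡opp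
      ... | no x≢i  | no x≢opp  = outside x≢i x≢opp

      balanced : Balanced (answer pos i a)
      paired balanced x h with place x
      ... | at-first  ≡.refl = ⊥-elim (just≢nothing (≡.trans (≡.sym at-i) h))
      ... | at-second ≡.refl = ⊥-elim (just≢nothing (≡.trans (≡.sym at-opposite) h))
      ... | outside x≢i x≢opp with opposite-elsewhere x x≢i x≢opp
      ...   | ox≢i , ox≢opp = ≡.trans (elsewhere (opposite x) ox≢i ox≢opp)
                                      (paired bal x (≡.trans (≡.sym (elsewhere x x≢i x≢opp)) h))
      cancels balanced x with place x
      ... | at-first ≡.refl rewrite at-i | at-opposite = -‿inverseʳ a
      ... | at-second ≡.refl rewrite opposite-involutive i | at-i | at-opposite = -‿inverseˡ a
      ... | outside x≢i x≢opp with opposite-elsewhere x x≢i x≢opp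
      ...   | ox≢i , ox≢opp rewrite elsewhere x x≢i x≢opp | elsewhere (opposite x) ox≢i ox≢opp = cancels bal x
      middle balanced x fixed with place x
      ... | at-first  ≡.refl = ⊥-elim (i≢opposite (≡.sym fixed))
      ... | at-second ≡.refl = ⊥-elim (i≢opposite (≡.trans (≡.sym (opposite-involutive i)) fixed))
      ... | outside x≢i x≢opp = ≡.trans (elsewhere x x≢i x≢opp) (middle bal x fixed)

    wanda-wins : ∀ k pos → Balanced pos → WandaWins D d (double k) nora pos
    wanda-wins zero    pos bal = root-at-one d (value pos) (balanced-sum bal)
    wanda-wins (suc k) pos bal i a free legal =
      opposite i , - a , Answer.partner-free bal i a free , legal-answer i a legal ,
      wanda-wins k (answer pos i a) (Answer.balanced bal i a free)
  open Game

  odd-degree-win : ∀ k → WandaHasWinningStrategy D (suc (double k)) nora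
  odd-degree-win k = wanda-wins d (suc k) (empty D d) (record
    { paired  = λ _ _ → ≡.refl
    ; cancels = λ _ → +-identityʳ 0#
    ; middle  = λ i fixed → ⊥-elim (no-midpoint k i fixed)
    })
    where
    d = suc (double k)

  even-degree-win : ∀ k → 2 ≤ double k → WandaHasWinningStrategy D (double k) wanda
  even-degree-win k 2≤d = midpoint k , 0# , ≡.refl , (λ end _ → midpoint-interior k 2≤d end) ,
    wanda-wins d k opening (record { paired = opening-paired ; cancels = opening-cancels ; middle = opening-middle })
    where
    d = double k
    opening : Position D d
    opening = update D d (empty D d) (midpoint k) 0#

    opening-midpoint : opening (midpoint k) ≡ just 0#
    opening-midpoint = update-same d (empty D d) (midpoint k) 0#

    -- a free index is not the midpoint, and neither is its partner
    opening-paired : ∀ x → opening x ≡ nothing → opening (opposite x) ≡ nothing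
    opening-paired x free = update-other d (empty D d) (midpoint k) 0# (opposite x) opp≢mid
      where
      opp≢mid : ¬ opposite x ≡ midpoint k
      opp≢mid opp≡mid = just≢nothing (≡.trans (≡.sym opening-midpoint) (≡.subst (λ y → opening y ≡ nothing) x≡mid free))
        where
        x≡mid : x ≡ midpoint k
        x≡mid = ≡.trans (≡.sym (opposite-involutive x)) (≡.trans (≡.cong opposite opp≡mid) (midpoint-fixed k))

    opening-value : ∀ x → value d opening x ≈ 0#
    opening-value x with x ≟ midpoint k
    ... | yes _ = refl
    ... | no  _ = refl

    opening-cancels : ∀ x → value d opening x + value d opening (opposite x) ≈ 0#
    opening-cancels x = trans (+-cong (opening-value x) (opening-value (opposite x))) (+-identityʳ 0#)

    opening-middle : ∀ x → opposite x ≡ x → opening x ≡ just 0#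
    opening-middle x fixed = ≡.subst (λ y → opening y ≡ just 0#) (≡.sym (fixed⇒midpoint k x fixed)) opening-midpoint

-- The theorem: by parity, Wanda moving last means either d is even and she
-- starts, or d is odd and Nora starts.
lemma3p1 : ∀ {c ℓ} → ExcludedMiddle (c ⊔ ℓ) → (D : IntegralDomain c ℓ) (d : ℕ) → 2 ≤ d → (first : Player) → mover first d ≡ wanda → WandaHasWinningStrategy D d first
lemma3p1 _ D d 2≤d first last with wanda-moves-last first d last
... | inj₁ (k , ≡.refl , ≡.refl) = even-degree-win D k 2≤d
... | inj₂ (k , ≡.refl , ≡.refl) = odd-degree-win D k
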